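{- Let $G=(V,E)$ be a $k$-critical graph, let $M$ be a non-trivial module of $G$ with $\chi(G[M])=\ell$, and let $G'$ be the graph obtained from $G$ by substituting a clique $K$ on $\ell$ vertices for $M$. Then $G'$ is $k$-critical.
   Context: All graphs are finite and simple. A graph is $k$-critical if its chromatic number is $k$ and every proper induced subgraph is $(k-1)$-colorable. A set $X$ of vertices of $G=(V,E)$ is a module if every vertex $v\notin X$ is adjacent either to all vertices of $X$ or to none of them; it is non-trivial if $|X|\ge 2$ and $X\ne V$. Substituting a graph $H$ for a module $M$ of $G$ means: delete $M$, add a disjoint copy of $H$, and join each vertex $x\in V\setminus M$ to all vertices of $H$ whenever $x$ has a neighbor in $M$ in $G$ (other adjacencies unchanged). -}

module Defs where

open import Data.Nat using (ℕ; _<_; _≤_; _∸_)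
open import Data.Fin using (Fin; _≟_)
open import Data.Bool using (Bool; true; false; not; _∧_)
open import Data.Sum using (_⊎_; inj₁; inj₂)
open import Data.Product using (Σ; _×_; ∃; ∃-syntax; _,_)
open import Data.List using (allFin)
open import Data.Bool.ListAction using (any)
open import Relation.Nullary using (¬_; ⌊_⌋)
open import Relation.Binary.PropositionalEquality using (_≡_; _≢_)

record Graph : Set₁ where
  field
    V   : Set
    adj : V → V → Bool
open Graph public

FinGraph : (n : ℕ) → (Fin n → Fin n → Bool) → Graph
FinGraph n a = record { V = Fin n ; adj = a }

record SimpleOn (n : ℕ) (a : Fin n → Fin n → Bool) : Set where
  field
    symm    : ∀ u v → a u v ≡ a v u
    irrefl  : ∀ v → a v v ≡ false

VSet : Graph → Set
VSet G = V G → Bool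

_∈ᵥ_ : {G : Graph} → V G → VSet G → Set
v ∈ᵥ S = S v ≡ true

_∉ᵥ_ : {G : Graph} → V G → VSet G → Set
v ∉ᵥ S = S v ≡ false

ColouringOn : (G : Graph) → VSet G → ℕ → Set
ColouringOn G S c =
  Σ ((v : V G) → S v ≡ true → Fin c) λ f →
    ∀ u v (hu : S u ≡ true) (hv : S v ≡ true) → adj G u v ≡ true → f u hu ≢ f v hv

ColourableOn : (G : Graph) → VSet G → ℕ → Set
ColourableOn G S c = ColouringOn G S c

ChromaticOn : (G : Graph) → VSet G → ℕ → Set
ChromaticOn G S k = ColourableOn G S k × (∀ c → c < k → ¬ ColourableOn G S c)

full : (G : Graph) → VSet G
full G _ = true

Chromatic : Graph → ℕ → Set
Chromatic G k = ChromaticOn G (full G) k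

Critical : Graph → ℕ → Set
Critical G k =
  Chromatic G k ×
  (∀ (S : VSet G) → (∃[ v ] (S v ≡ false)) → ColourableOn G S (k ∸ 1))

IsModule : {n : ℕ} → (Fin n → Fin n → Bool) → (Fin n → Bool) → Set
IsModule {n} a M =
  ∀ (x : Fin n) → M x ≡ false →
    (∀ m → M m ≡ true → a x m ≡ true) ⊎ (∀ m → M m ≡ true → a x m ≡ false)

NonTrivial : {n : ℕ} → (Fin n → Bool) → Set
NonTrivial {n} M =
  (Σ (Fin n) λ u → Σ (Fin n) λ v → u ≢ v × M u ≡ true × M v ≡ true) ×
  (∃[ w ] (M w ≡ false))

hasNbrIn : {n : ℕ} → (Fin n → Fin n → Bool) → (Fin n → Bool) → Fin n → Bool
hasNbrIn {n} a M x = any (λ m → M m ∧ a x m) (allFin n)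

substClique : (n : ℕ) → (Fin n → Fin n → Bool) → (Fin n → Bool) → ℕ → Graph
substClique n a M ℓ = record { V = VV ; adj = A }
  where
  VV : Set
  VV = (Σ (Fin n) λ v → M v ≡ false) ⊎ Fin ℓ
  A : VV → VV → Bool
  A (inj₁ (x , _)) (inj₁ (y , _)) = a x y
  A (inj₁ (x , _)) (inj₂ _)       = hasNbrIn a M x
  A (inj₂ _)       (inj₁ (y , _)) = hasNbrIn a M y
  A (inj₂ i)       (inj₂ j)       = not ⌊ i ≟ j ⌋

module Submission where

-- Colourings move between
-- G and G′ in both directions:
--   * G → G′ (lift): if f properly colours G[T] with M ⊆ T, then f uses at least
--     χ(G[M ∩ T]) distinct colours on M (a "palette", obtained by enumerating the
--     used colours and recolouring by rank).  Giving the clique vertices distinct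
--     palette colours extends f to G′, because an outside vertex adjacent to K is
--     adjacent to all of M, hence to a vertex carrying each palette colour.
--   * G′ → G (project): an ℓ-colouring of G[M] maps G homomorphically onto G′, so
--     colourings of G′ pull back to G.
-- Hence χ(G′) = k.  For criticality, delete a vertex from G′: if it lies outside
-- K, delete the same vertex from G; if it lies in K, delete any vertex m₀ ∈ M,
-- which lowers χ(G[M]) by at most one, so ℓ - 1 palette colours suffice for the
-- remaining clique vertices.  In both cases a (k-1)-colouring of the smaller
-- induced subgraph of G lifts to the smaller induced subgraph of G′.

open import Defs
open import Data.Nat using (ℕ; zero; suc; _<_; _≤_; _∸_; s≤s)
open import Data.Nat.Properties using (≰⇒>; _≤?_)
open import Data.Fin using (Fin; zero; suc; _≟_; inject≤; punchOut)
open import Data.Fin.Properties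
  using (any?; suc-injective; inject≤-injective; punchOut-injective)
open import Data.Bool using (Bool; true; false; not; _∧_)
open import Data.Bool.Properties using (∧-conicalˡ; ∧-conicalʳ; T-≡)
  renaming (_≟_ to _≟ᵇ_)
open import Data.Bool.ListAction using (any)
open import Data.List using (allFin)
open import Data.List.Membership.Propositional using (lose)
open import Data.List.Membership.Propositional.Properties using (∈-allFin)
open import Data.List.Relation.Unary.Any using (satisfied)
open import Data.List.Relation.Unary.Any.Properties using (any⁺; any⁻)
open import Data.Sum using (_⊎_; inj₁; inj₂)
open import Data.Product using (Σ; _×_; ∃-syntax; _,_; proj₁; proj₂)
open import Data.Empty using (⊥-elim)
open import Function using (_∘_)
open import Function.Bundles using (Equivalence)
open import Relation.Nullary using (¬_; Dec; yes; no; ⌊_⌋)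
open import Relation.Binary.PropositionalEquality
  using (_≡_; _≢_; refl; sym; trans; cong; subst)
open import Axiom.UniquenessOfIdentityProofs using (module Decidable⇒UIP)

-- Membership proofs `S v ≡ true` are unique, so colourings do not depend on them.
≡ᵇ-irrelevant : {x y : Bool} (p q : x ≡ y) → p ≡ q
≡ᵇ-irrelevant = Decidable⇒UIP.≡-irrelevant _≟ᵇ_

true≢false : true ≢ false
true≢false ()

true-or-false : (b : Bool) → b ≡ true ⊎ b ≡ false
true-or-false true  = inj₁ refl
true-or-false false = inj₂ refl

_⊆_ : {A : Set} → (A → Bool) → (A → Bool) → Set
S₁ ⊆ S₂ = ∀ v → S₁ v ≡ true → S₂ v ≡ true

_∩_ : {A : Set} → (A → Bool) → (A → Bool) → A → Bool
(S₁ ∩ S₂) v = S₁ v ∧ S₂ v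

∩-intro : {x y : Bool} → x ≡ true → y ≡ true → x ∧ y ≡ true
∩-intro refl refl = refl

-- All vertices except v.  Note that the clique adjacency `not ⌊ i ≟ j ⌋` of
-- substClique is `allBut j i`.
allBut : {n : ℕ} → Fin n → Fin n → Bool
allBut v y = not ⌊ y ≟ v ⌋

allBut-self : {n : ℕ} (v : Fin n) → allBut v v ≡ false
allBut-self v with v ≟ v
... | yes _   = refl
... | no v≢v = ⊥-elim (v≢v refl)

≢⇒allBut : {n : ℕ} {v y : Fin n} → y ≢ v → allBut v y ≡ true
≢⇒allBut {v = v} {y} y≢v with y ≟ v
... | yes y≡v = ⊥-elim (y≢v y≡v)
... | no _    = refl

allBut⇒≢ : {n : ℕ} {v y : Fin n} → allBut v y ≡ true → y ≢ v
allBut⇒≢ {v = v} y∈ refl = true≢false (trans (sym y∈) (allBut-self v))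

ChromaticAtLeast : (G : Graph) → VSet G → ℕ → Set
ChromaticAtLeast G S d = ∀ c → c < d → ¬ ColourableOn G S c

restrict : {G : Graph} {S₁ S₂ : VSet G} {c : ℕ} →
  S₁ ⊆ S₂ → ColouringOn G S₂ c → ColouringOn G S₁ c
restrict S₁⊆S₂ (f , proper) =
  (λ v s → f v (S₁⊆S₂ v s)) , λ u v _ _ → proper u v _ _

ChromaticAtLeast-mono : {G : Graph} {S₁ S₂ : VSet G} {d : ℕ} →
  S₁ ⊆ S₂ → ChromaticAtLeast G S₁ d → ChromaticAtLeast G S₂ d
ChromaticAtLeast-mono S₁⊆S₂ χ≥d c c<d = χ≥d c c<d ∘ restrict S₁⊆S₂

pullback-colouring : {G H : Graph} {c : ℕ} (φ : V G → V H) →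
  (∀ u v → adj G u v ≡ true → adj H (φ u) (φ v) ≡ true) →
  ColouringOn H (full H) c → ColouringOn G (full G) c
pullback-colouring φ hom (g , proper) =
  (λ v _ → g (φ v) refl) , λ u v _ _ uv → proper (φ u) (φ v) refl refl (hom u v uv)

-- Deleting one vertex lowers the chromatic number by at most one: a colouring of
-- G[S ∖ {w}] extends to G[S] by giving w a fresh colour.
delete-vertex-bound : {n : ℕ} {a : Fin n → Fin n → Bool} → (∀ v → a v v ≡ false) →
  {S : Fin n → Bool} {d : ℕ} (w : Fin n) →
  ChromaticAtLeast (FinGraph n a) S d →
  ChromaticAtLeast (FinGraph n a) (S ∩ allBut w) (d ∸ 1)
delete-vertex-bound {n} {a} irrefl {S} {suc d} w χ≥d c c<d-1 (g , proper) =
  χ≥d (suc c) (s≤s c<d-1) (extend , extend-proper)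
  where
  colour : ∀ v → S v ≡ true → Dec (v ≡ w) → Fin (suc c)
  colour v _   (yes _)   = zero
  colour v v∈S (no v≢w) = suc (g v (∩-intro v∈S (≢⇒allBut v≢w)))

  colour-proper : ∀ u v u∈S v∈S u≟w v≟w → a u v ≡ true →
    colour u u∈S u≟w ≢ colour v v∈S v≟w
  colour-proper u v _ _ (yes refl) (yes refl) uu _ = true≢false (trans (sym uu) (irrefl u))
  colour-proper u v _ _ (yes _) (no _) _ ()
  colour-proper u v _ _ (no _) (yes _) _ ()
  colour-proper u v _ _ (no _) (no _) uv = proper u v _ _ uv ∘ suc-injective

  extend : (v : Fin n) → S v ≡ true → Fin (suc c)
  extend v v∈S = colour v v∈S (v ≟ w)

  extend-proper : ∀ u v u∈S v∈S → a u v ≡ true → extend u u∈S ≢ extend v v∈S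
  extend-proper u v u∈S v∈S = colour-proper u v u∈S v∈S (u ≟ w) (v ≟ w)

skip : {ℓ : ℕ} {i j : Fin ℓ} → i ≢ j → Fin (ℓ ∸ 1)
skip {suc _} i≢j = punchOut i≢j

skip-injective : {ℓ : ℕ} {i j j′ : Fin ℓ} (i≢j : i ≢ j) (i≢j′ : i ≢ j′) →
  skip i≢j ≡ skip i≢j′ → j ≡ j′
skip-injective {suc _} = punchOut-injective

record Enumeration {c : ℕ} (P : Fin c → Set) : Set where
  field
    size           : ℕ
    elem           : Fin size → Fin c
    elem-injective : ∀ i j → elem i ≡ elem j → i ≡ j
    elem-sound     : ∀ i → P (elem i)
    rank           : ∀ j → P j → Fin size
    elem-rank      : ∀ j p → elem (rank j p) ≡ j

extend-enumeration : {c : ℕ} {P : Fin (suc c) → Set} →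
  Dec (P zero) → Enumeration (P ∘ suc) → Enumeration P
extend-enumeration {c} {P} (yes p₀) E = record
  { size = suc size ; elem = elem′ ; elem-injective = injective′
  ; elem-sound = sound′ ; rank = rank′ ; elem-rank = elem-rank′ }
  where
  open Enumeration E
  elem′ : Fin (suc size) → Fin (suc c)
  elem′ zero    = zero
  elem′ (suc i) = suc (elem i)
  injective′ : ∀ i j → elem′ i ≡ elem′ j → i ≡ j
  injective′ zero    zero    _ = refl
  injective′ (suc i) (suc j) q = cong suc (elem-injective i j (suc-injective q))
  sound′ : ∀ i → P (elem′ i)
  sound′ zero    = p₀
  sound′ (suc i) = elem-sound i
  rank′ : ∀ j → P j → Fin (suc size)
  rank′ zero    _ = zero
  rank′ (suc j) p = suc (rank j p)
  elem-rank′ : ∀ j p → elem′ (rank′ j p) ≡ j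
  elem-rank′ zero    _ = refl
  elem-rank′ (suc j) p = cong suc (elem-rank j p)
extend-enumeration {P = P} (no ¬p₀) E = record
  { size = size ; elem = suc ∘ elem
  ; elem-injective = λ i j → elem-injective i j ∘ suc-injective
  ; elem-sound = elem-sound ; rank = rank′ ; elem-rank = elem-rank′ }
  where
  open Enumeration E
  rank′ : ∀ j → P j → Fin size
  rank′ zero    p = ⊥-elim (¬p₀ p)
  rank′ (suc j) p = rank j p
  elem-rank′ : ∀ j p → suc (elem (rank′ j p)) ≡ j
  elem-rank′ zero    p = ⊥-elim (¬p₀ p)
  elem-rank′ (suc j) p = cong suc (elem-rank j p)

enumerate : {c : ℕ} {P : Fin c → Set} → (∀ j → Dec (P j)) → Enumeration P
enumerate {zero} _ = record
  { size = 0 ; elem = λ () ; elem-injective = λ ()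
  ; elem-sound = λ () ; rank = λ () ; elem-rank = λ () }
enumerate {suc c} P? = extend-enumeration (P? zero) (enumerate (P? ∘ suc))

UsedOn : {n c : ℕ} {T : Fin n → Bool} →
  ((v : Fin n) → T v ≡ true → Fin c) → (Fin n → Bool) → Fin c → Set
UsedOn {T = T} f M j = ∃[ m ] (M m ≡ true × Σ (T m ≡ true) λ t → f m t ≡ j)

usedOn? : {n c : ℕ} {T : Fin n → Bool} (f : (v : Fin n) → T v ≡ true → Fin c)
  (M : Fin n → Bool) (j : Fin c) → Dec (UsedOn f M j)
usedOn? {T = T} f M j = any? used-at
  where
  used-at : ∀ m → Dec (M m ≡ true × Σ (T m ≡ true) λ t → f m t ≡ j)
  used-at m with M m ≟ᵇ true | T m ≟ᵇ true
  ... | no m∉M | _      = no (m∉M ∘ proj₁)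
  ... | yes _  | no m∉T = no (m∉T ∘ proj₁ ∘ proj₂)
  ... | yes m∈M | yes m∈T with f m m∈T ≟ j
  ...   | yes same  = yes (m∈M , m∈T , same)
  ...   | no differ = no λ (_ , t , same) →
            differ (subst (λ t′ → f m t′ ≡ j) (≡ᵇ-irrelevant t m∈T) same)

record Palette {n c : ℕ} {T : Fin n → Bool}
    (f : (v : Fin n) → T v ≡ true → Fin c) (M : Fin n → Bool) (d : ℕ) : Set where
  field
    colour           : Fin d → Fin c
    colour-injective : ∀ i j → colour i ≡ colour j → i ≡ j
    colour-used      : ∀ i → UsedOn f M (colour i)

-- A colouring of G[T] uses at least χ(G[M ∩ T]) colours on M: otherwise recolouring
-- each vertex of M ∩ T by the rank of its colour among the used ones would colour
-- G[M ∩ T] with fewer colours.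
palette : {n c d : ℕ} {a : Fin n → Fin n → Bool} {T M : Fin n → Bool}
  (F : ColouringOn (FinGraph n a) T c) →
  ChromaticAtLeast (FinGraph n a) (M ∩ T) d → Palette (proj₁ F) M d
palette {n} {d = d} {a} {T} {M} (f , proper) χ≥d = from-size (d ≤? size)
  where
  open Enumeration (enumerate (usedOn? f M))

  by-rank : ColouringOn (FinGraph n a) (M ∩ T) size
  by-rank = recolour , recolour-proper
    where
    recolour : (v : Fin n) → (M ∩ T) v ≡ true → Fin size
    recolour v v∈ = rank (f v _) (v , ∧-conicalˡ _ _ v∈ , ∧-conicalʳ _ _ v∈ , refl)
    recolour-proper : ∀ u v u∈ v∈ → a u v ≡ true → recolour u u∈ ≢ recolour v v∈
    recolour-proper u v _ _ uv same = proper u v _ _ uv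
      (trans (sym (elem-rank _ _)) (trans (cong elem same) (elem-rank _ _)))

  from-size : Dec (d ≤ size) → Palette f M d
  from-size (yes d≤size) = record
    { colour = λ i → elem (inject≤ i d≤size)
    ; colour-injective = λ i j → inject≤-injective d≤size d≤size i j ∘ elem-injective _ _
    ; colour-used = λ i → elem-sound _ }
  from-size (no d≰size) = ⊥-elim (χ≥d size (≰⇒> d≰size) by-rank)

module-neighbour : {n : ℕ} {a : Fin n → Fin n → Bool} {M : Fin n → Bool} →
  IsModule a M → ∀ x → M x ≡ false → hasNbrIn a M x ≡ true →
  ∀ m → M m ≡ true → a x m ≡ true
module-neighbour {n} mod x x∉M x∼M m m∈M with mod x x∉M
... | inj₁ complete = complete m m∈M
... | inj₂ anticomplete
  with m′ , m′∼x ← satisfied (any⁻ _ (allFin n) (Equivalence.from T-≡ x∼M)) =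
  ⊥-elim (true≢false (trans (sym (∧-conicalʳ _ _ (Equivalence.to T-≡ m′∼x)))
                           (anticomplete m′ (∧-conicalˡ _ _ (Equivalence.to T-≡ m′∼x)))))

hasNbrIn-intro : {n : ℕ} (a : Fin n → Fin n → Bool) (M : Fin n → Bool) {x m : Fin n} →
  M m ≡ true → a x m ≡ true → hasNbrIn a M x ≡ true
hasNbrIn-intro a M {m = m} m∈M xm =
  Equivalence.to T-≡ (any⁺ _ (lose (∈-allFin m) (Equivalence.from T-≡ (∩-intro m∈M xm))))

module Substitution {n : ℕ} (a : Fin n → Fin n → Bool) (simple : SimpleOn n a)
    (M : Fin n → Bool) (mod : IsModule a M) (ℓ : ℕ) where

  open SimpleOn simple

  G G′ : Graph
  G  = FinGraph n a
  G′ = substClique n a M ℓ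

  OuterWithin : VSet G′ → (Fin n → Bool) → Set
  OuterWithin S′ T = ∀ x (x∉M : M x ≡ false) → S′ (inj₁ (x , x∉M)) ≡ true → T x ≡ true

  lift-colouring : {T : Fin n → Bool} {c d : ℕ} (F : ColouringOn G T c) →
    Palette (proj₁ F) M d → (S′ : VSet G′) → OuterWithin S′ T →
    (h : (i : Fin ℓ) → S′ (inj₂ i) ≡ true → Fin d) →
    (∀ i j i∈ j∈ → h i i∈ ≡ h j j∈ → i ≡ j) → ColouringOn G′ S′ c
  lift-colouring {c = c} (f , proper) P S′ outer h h-injective = colour′ , proper′
    where
    open Palette P
    colour′ : (v : V G′) → S′ v ≡ true → Fin c
    colour′ (inj₁ (x , x∉M)) x∈ = f x (outer x x∉M x∈)
    colour′ (inj₂ i) i∈ = colour (h i i∈)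

    proper′ : ∀ u v u∈ v∈ → adj G′ u v ≡ true → colour′ u u∈ ≢ colour′ v v∈
    proper′ (inj₁ (x , _)) (inj₁ (y , _)) _ _ xy = proper x y _ _ xy
    proper′ (inj₁ (x , x∉M)) (inj₂ i) _ i∈ x∼M same
      with m , m∈M , m∈T , fm ← colour-used (h i i∈) =
      proper x m _ m∈T (module-neighbour mod x x∉M x∼M m m∈M) (trans same (sym fm))
    proper′ (inj₂ i) (inj₁ (y , y∉M)) i∈ _ y∼M same
      with m , m∈M , m∈T , fm ← colour-used (h i i∈) =
      proper m y m∈T _ (trans (symm m y) (module-neighbour mod y y∉M y∼M m m∈M))
        (trans fm same)
    proper′ (inj₂ i) (inj₂ j) i∈ j∈ i≁j same =
      allBut⇒≢ i≁j (h-injective i j i∈ j∈ (colour-injective _ _ same))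

  lift-over-module : {T : Fin n → Bool} {c : ℕ} → M ⊆ T →
    ChromaticAtLeast G M ℓ → ColouringOn G T c →
    (S′ : VSet G′) → OuterWithin S′ T → ColouringOn G′ S′ c
  lift-over-module M⊆T χM≥ℓ F S′ outer =
    lift-colouring F (palette F (ChromaticAtLeast-mono M⊆M∩T χM≥ℓ)) S′ outer
      (λ i _ → i) (λ _ _ _ _ same → same)
    where
    M⊆M∩T : M ⊆ (M ∩ _)
    M⊆M∩T m m∈M = ∩-intro m∈M (M⊆T m m∈M)

  collapse-at : ColouringOn G M ℓ → ∀ x → M x ≡ true ⊎ M x ≡ false → V G′
  collapse-at (g , _) x (inj₁ x∈M) = inj₂ (g x x∈M)
  collapse-at _       x (inj₂ x∉M) = inj₁ (x , x∉M)

  collapse : ColouringOn G M ℓ → Fin n → V G′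
  collapse H x = collapse-at H x (true-or-false (M x))

  collapse-homomorphism : (H : ColouringOn G M ℓ) →
    ∀ u v → a u v ≡ true → adj G′ (collapse H u) (collapse H v) ≡ true
  collapse-homomorphism H@(g , proper) u v =
    by-side (true-or-false (M u)) (true-or-false (M v))
    where
    by-side : ∀ su sv → a u v ≡ true →
      adj G′ (collapse-at H u su) (collapse-at H v sv) ≡ true
    by-side (inj₁ u∈M) (inj₁ v∈M) uv = ≢⇒allBut (proper u v u∈M v∈M uv)
    by-side (inj₁ u∈M) (inj₂ _)   uv = hasNbrIn-intro a M u∈M (trans (symm v u) uv)
    by-side (inj₂ _)   (inj₁ v∈M) uv = hasNbrIn-intro a M v∈M uv
    by-side (inj₂ _)   (inj₂ _)   uv = uv

  project-colouring : {c : ℕ} → ColouringOn G M ℓ →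
    ColouringOn G′ (full G′) c → ColouringOn G (full G) c
  project-colouring H = pullback-colouring (collapse H) (collapse-homomorphism H)

  module Deletion (k : ℕ) (χM≥ℓ : ChromaticAtLeast G M ℓ)
      (crit : ∀ (S : VSet G) → ∃[ v ] (S v ≡ false) → ColourableOn G S (k ∸ 1)) where

    delete-outer : (S′ : VSet G′) → ∀ x x∉M → S′ (inj₁ (x , x∉M)) ≡ false →
      ColourableOn G′ S′ (k ∸ 1)
    delete-outer S′ x x∉M x∉S′ =
      lift-over-module M⊆G−x χM≥ℓ (crit (allBut x) (x , allBut-self x)) S′ outer
      where
      M⊆G−x : M ⊆ allBut x
      M⊆G−x m m∈M = ≢⇒allBut λ { refl → true≢false (trans (sym m∈M) x∉M) }
      outer : OuterWithin S′ (allBut x)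
      outer y y∉M y∈S′ = ≢⇒allBut λ { refl → true≢false (trans (sym y∈S′)
        (trans (cong (λ p → S′ (inj₁ (y , p))) (≡ᵇ-irrelevant y∉M x∉M)) x∉S′)) }

    -- Deleting a clique vertex i from G′: colour G − m₀ for some m₀ ∈ M; its
    -- palette on M has ℓ - 1 colours, enough for the clique vertices other than i.
    delete-clique : ∀ m₀ → M m₀ ≡ true → (S′ : VSet G′) → ∀ i →
      S′ (inj₂ i) ≡ false → ColourableOn G′ S′ (k ∸ 1)
    delete-clique m₀ m₀∈M S′ i i∉S′ =
      lift-colouring F (palette F (delete-vertex-bound irrefl m₀ χM≥ℓ)) S′ outer
        (λ j j∈ → skip (deleted≢ j j∈))
        (λ j j′ j∈ j′∈ → skip-injective (deleted≢ j j∈) (deleted≢ j′ j′∈))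
      where
      F : ColouringOn G (allBut m₀) (k ∸ 1)
      F = crit (allBut m₀) (m₀ , allBut-self m₀)
      outer : OuterWithin S′ (allBut m₀)
      outer y y∉M _ = ≢⇒allBut λ { refl → true≢false (trans (sym m₀∈M) y∉M) }
      deleted≢ : ∀ j → S′ (inj₂ j) ≡ true → i ≢ j
      deleted≢ j j∈ refl = true≢false (trans (sym j∈) i∉S′)

lemma8 : (n k ℓ : ℕ) (a : Fin n → Fin n → Bool) → SimpleOn n a →
    Critical (FinGraph n a) k →
    (M : Fin n → Bool) → IsModule a M → NonTrivial M →
    ChromaticOn (FinGraph n a) M ℓ →
    Critical (substClique n a M ℓ) k
lemma8 n k ℓ a simple ((G-colourable , χG≥k) , crit) M mod
       ((m₀ , _ , _ , m₀∈M , _) , _) (M-colourable , χM≥ℓ) =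
  (G′-colourable , χG′≥k) , G′-critical
  where
  open Substitution a simple M mod ℓ
  open Deletion k χM≥ℓ crit

  G′-colourable : ColourableOn G′ (full G′) k
  G′-colourable =
    lift-over-module (λ _ _ → refl) χM≥ℓ G-colourable (full G′) (λ _ _ _ → refl)

  χG′≥k : ChromaticAtLeast G′ (full G′) k
  χG′≥k c c<k = χG≥k c c<k ∘ project-colouring M-colourable

  G′-critical : ∀ (S′ : VSet G′) → ∃[ v ] (S′ v ≡ false) → ColourableOn G′ S′ (k ∸ 1)
  G′-critical S′ (inj₁ (x , x∉M) , x∉S′) = delete-outer S′ x x∉M x∉S′
  G′-critical S′ (inj₂ i , i∉S′)         = delete-clique m₀ m₀∈M S′ i i∉S′
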